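{- The property $\neg\mathrm{AC}$ of abstract rewrite systems is not a generalised first-order property.
   Context: An ARS is a pair $(A,\to)$, $A$ non-empty, ${\to}\subseteq A\times A$; $\to^+$ is the transitive closure. The ARS is acyclic (AC) if $a\to^+b$ implies $a\neq b$; $\neg\mathrm{AC}$ is the property of not being acyclic. A property $P$ is a generalised first-order property if there is a set $\Phi$ of sentences of first-order logic with equality and a binary predicate symbol $\to$ (interpreted as the one-step relation) such that for every ARS $\mathcal{A}$, $\mathcal{A}$ has $P$ iff $\mathcal{A}\models\Phi$. -}

module Defs where

open import Data.Nat using (ℕ; zero; suc)
open import Data.Fin using (Fin; zero; suc)
open import Data.Product using (Σ; _×_)
open import Data.Sum using (_⊎_)
open import Data.Empty using (⊥)
open import Relation.Nullary using (¬_)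
open import Relation.Binary.PropositionalEquality using (_≡_; _≢_)
open import Relation.Binary.Construct.Closure.Transitive using (TransClosure)
open import Function.Bundles using (_⇔_)

record ARS : Set₁ where
  field
    Carrier : Set
    _⟶_     : Carrier → Carrier → Set
    inhabitant : Carrier

open ARS public

Acyclic : ARS → Set
Acyclic 𝒜 = ∀ {a b} → TransClosure (_⟶_ 𝒜) a b → a ≢ b

NotAC : ARS → Set
NotAC 𝒜 = ¬ Acyclic 𝒜

-- First-order formulas with equality and one binary predicate symbol ⟶,
-- with n free variables (de Bruijn indices in Fin n).
data Fm (n : ℕ) : Set where
  _≐_   : Fin n → Fin n → Fm n
  _⇀_   : Fin n → Fin n → Fm n
  falsum : Fm n
  _∧′_ _∨′_ _⇒′_ : Fm n → Fm n → Fm n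
  ∀′ ∃′ : Fm (suc n) → Fm n

Sentence : Set
Sentence = Fm 0

extend : {A : Set} {n : ℕ} → A → (Fin n → A) → Fin (suc n) → A
extend a ρ zero    = a
extend a ρ (suc i) = ρ i

Sat : (𝒜 : ARS) {n : ℕ} → Fm n → (Fin n → Carrier 𝒜) → Set
Sat 𝒜 (i ≐ j)   ρ = ρ i ≡ ρ j
Sat 𝒜 (i ⇀ j)   ρ = _⟶_ 𝒜 (ρ i) (ρ j)
Sat 𝒜 falsum    ρ = ⊥
Sat 𝒜 (φ ∧′ ψ)  ρ = Sat 𝒜 φ ρ × Sat 𝒜 ψ ρ
Sat 𝒜 (φ ∨′ ψ)  ρ = Sat 𝒜 φ ρ ⊎ Sat 𝒜 ψ ρ
Sat 𝒜 (φ ⇒′ ψ)  ρ = Sat 𝒜 φ ρ → Sat 𝒜 ψ ρ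
Sat 𝒜 (∀′ φ)    ρ = (a : Carrier 𝒜) → Sat 𝒜 φ (extend a ρ)
Sat 𝒜 (∃′ φ)    ρ = Σ (Carrier 𝒜) λ a → Sat 𝒜 φ (extend a ρ)

_⊨_ : ARS → Sentence → Set
𝒜 ⊨ φ = Sat 𝒜 φ (λ ())

_⊨ₛ_ : ARS → (Sentence → Set) → Set
𝒜 ⊨ₛ Φ = (φ : Sentence) → Φ φ → 𝒜 ⊨ φ

GeneralisedFO : (ARS → Set) → Set₁
GeneralisedFO P = Σ (Sentence → Set) λ Φ → (𝒜 : ARS) → P 𝒜 ⇔ (𝒜 ⊨ₛ Φ)

-- Let Chains be the disjoint union of infinitely many ℤ-chains, and add to it a
-- cycle of length greater than 2^d. Chains is acyclic, the extension is not, yet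
-- they satisfy the same sentences of quantifier depth d: by a back-and-forth
-- argument, tuples in the two structures that satisfy the same equations
-- next^a ρᵢ = next^b ρⱼ with a, b ≤ 2^(k+1) can be extended by one point each so
-- that this stays true for a, b ≤ 2^k. A new point within distance 2^k of an old
-- one is placed at the same offset; any other point is matched with a point of
-- an unused orbit, and on both sides its first 2^k iterates are distinct. If Φ
-- axiomatised ¬AC, every φ ∈ Φ would hold in the cycle of length 2^(depth φ) + 1
-- added to Chains, hence in Chains, contradicting its acyclicity.
module Submission where

open import Defs
open import Relation.Nullary using (¬_; Dec; yes; no)

import Algebra.Properties.AbelianGroup as AbelianGroupProperties
open import Data.Empty using (⊥-elim)
open import Data.Fin as Fin using (Fin; zero; suc; toℕ; fromℕ<)
import Data.Fin.Properties as Fin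
open import Data.Integer as ℤ using (ℤ; +_)
import Data.Integer.Properties as ℤ
open import Data.Nat as ℕ using (ℕ; zero; suc; _+_; _≤_; _<_; _⊔_; z≤n; s≤s; s≤s⁻¹; _%_)
open import Data.Nat.DivMod using (m%n<n; m≤n⇒m%n≡m; n%n≡0)
open import Data.Nat.Properties hiding (_≟_)
open import Data.Product using (∃; Σ; _×_; _,_; proj₁; proj₂; map₁)
open import Data.Product.Function.NonDependent.Propositional using (_×-⇔_)
import Data.Product.Properties as Product
open import Data.Sum as Sum using (_⊎_; inj₁; inj₂)
open import Data.Sum.Function.Propositional using (_⊎-⇔_)
import Data.Sum.Properties as Sum
open import Function using (_∘_; const; _⇔_; mk⇔; Equivalence; Injective; StrictlySurjective)
import Function.Endo.Propositional as Endo
import Function.Properties.Equivalence as ⇔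
open import Function.Related.TypeIsomorphisms using (→-cong-⇔)
open import Relation.Binary.Construct.Closure.Transitive using (TransClosure; [_]; _∷_; _∷ʳ_)
open import Relation.Binary.Definitions using (DecidableEquality)
open import Relation.Binary.PropositionalEquality

≡-cong-⇔ : {A : Set} {u u′ v v′ : A} → u ≡ u′ → v ≡ v′ → (u ≡ v) ⇔ (u′ ≡ v′)
≡-cong-⇔ refl refl = ⇔.refl

module _ {A B : Set} (R : A → B → Set)
         (forth : ∀ a → ∃ (R a)) (back : ∀ b → ∃ λ a → R a b)
         {P : A → Set} {Q : B → Set} (P⇔Q : ∀ {a b} → R a b → P a ⇔ Q b) where

  Π-cong-⇔ : ((a : A) → P a) ⇔ ((b : B) → Q b)
  Π-cong-⇔ = mk⇔
    (λ ∀P b → let a , r = back b in Equivalence.to (P⇔Q r) (∀P a))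
    (λ ∀Q a → let b , r = forth a in Equivalence.from (P⇔Q r) (∀Q b))

  Σ-cong-⇔ : Σ A P ⇔ Σ B Q
  Σ-cong-⇔ = mk⇔
    (λ (a , p) → let b , r = forth a in b , Equivalence.to (P⇔Q r) p)
    (λ (b , q) → let a , r = back b in a , Equivalence.from (P⇔Q r) q)

maximum : ∀ {n} → (Fin n → ℕ) → ℕ
maximum {zero}  g = 0
maximum {suc n} g = g zero ⊔ maximum (g ∘ suc)

≤-maximum : ∀ {n} (g : Fin n → ℕ) i → g i ≤ maximum g
≤-maximum g zero    = m≤m⊔n (g zero) _
≤-maximum g (suc i) = ≤-trans (≤-maximum (g ∘ suc) i) (m≤n⊔m (g zero) _)

infixr 8 _^_

_^_ : {A : Set} → (A → A) → ℕ → A → A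
f ^ n = Endo._^_ _ f n

module _ {A : Set} (f : A → A) where

  ^-+ : ∀ m n x → (f ^ (m + n)) x ≡ (f ^ m) ((f ^ n) x)
  ^-+ m n = cong-app (Endo.^-homo _ f m n)

  ^-comm : ∀ m n x → (f ^ m) ((f ^ n) x) ≡ (f ^ n) ((f ^ m) x)
  ^-comm m n x = begin
    (f ^ m) ((f ^ n) x)  ≡⟨ ^-+ m n x ⟨
    (f ^ (m + n)) x      ≡⟨ cong (λ k → (f ^ k) x) (+-comm m n) ⟩
    (f ^ (n + m)) x      ≡⟨ ^-+ n m x ⟩
    (f ^ n) ((f ^ m) x)  ∎
    where open ≡-Reasoning

  ^-injective : Injective _≡_ _≡_ f → ∀ n → Injective _≡_ _≡_ (f ^ n)
  ^-injective inj zero    eq = eq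
  ^-injective inj (suc n) eq = ^-injective inj n (inj eq)

  ^-strictlySurjective : StrictlySurjective _≡_ f → ∀ n → StrictlySurjective _≡_ (f ^ n)
  ^-strictlySurjective surj zero    y = y , refl
  ^-strictlySurjective surj (suc n) y =
    let x , fx≡y = surj y
        w , fⁿw≡x = ^-strictlySurjective surj n x
    in  w , trans (cong f fⁿw≡x) fx≡y

  ^-preserves : {B : Set} (g : A → B) → (∀ x → g (f x) ≡ g x) → ∀ n x → g ((f ^ n) x) ≡ g x
  ^-preserves g g∘f≡g zero    x = refl
  ^-preserves g g∘f≡g (suc n) x = trans (g∘f≡g _) (^-preserves g g∘f≡g n x)

  module _ {m : ℕ} (period : ∀ x → (f ^ suc m) x ≡ x) where

    periodic⇒injective : Injective _≡_ _≡_ f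
    periodic⇒injective {x} {y} fx≡fy = begin
      x              ≡⟨ f^m∘f≡id x ⟨
      (f ^ m) (f x)  ≡⟨ cong (f ^ m) fx≡fy ⟩
      (f ^ m) (f y)  ≡⟨ f^m∘f≡id y ⟩
      y              ∎
      where
        open ≡-Reasoning
        f^m∘f≡id : ∀ x → (f ^ m) (f x) ≡ x
        f^m∘f≡id x = trans (^-comm m 1 x) (period x)

    periodic⇒strictlySurjective : StrictlySurjective _≡_ f
    periodic⇒strictlySurjective y = (f ^ m) y , period y

  module _ (inj : Injective _≡_ _≡_ f) {a b : ℕ} {r x : A} (shift : (f ^ a) r ≡ (f ^ b) x) where

    ^-shift-⇔ : ∀ c e z → ((f ^ c) x ≡ (f ^ e) z) ⇔ ((f ^ (c + a)) r ≡ (f ^ (e + b)) z)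
    ^-shift-⇔ c e z =
      ⇔.trans (mk⇔ (cong (f ^ b)) (^-injective inj b)) (≡-cong-⇔ moved (trans (^-comm b e z) (sym (^-+ e b z))))
      where
        open ≡-Reasoning
        moved : (f ^ b) ((f ^ c) x) ≡ (f ^ (c + a)) r
        moved = begin
          (f ^ b) ((f ^ c) x)  ≡⟨ ^-comm b c x ⟩
          (f ^ c) ((f ^ b) x)  ≡⟨ cong (f ^ c) shift ⟨
          (f ^ c) ((f ^ a) r)  ≡⟨ ^-+ c a r ⟨
          (f ^ (c + a)) r      ∎

    ^-shift-self-⇔ : ∀ c e → ((f ^ c) x ≡ (f ^ e) x) ⇔ ((f ^ (c + a)) r ≡ (f ^ (e + a)) r)
    ^-shift-self-⇔ c e = ⇔.trans (^-shift-⇔ c e x) (≡-cong-⇔ refl (begin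
      (f ^ (e + b)) x      ≡⟨ ^-+ e b x ⟩
      (f ^ e) ((f ^ b) x)  ≡⟨ cong (f ^ e) shift ⟨
      (f ^ e) ((f ^ a) r)  ≡⟨ ^-+ e a r ⟨
      (f ^ (e + a)) r      ∎))
      where open ≡-Reasoning

  ⁺⇒^ : ∀ {x y} → TransClosure (λ u v → f u ≡ v) x y → ∃ λ n → (f ^ suc n) x ≡ y
  ⁺⇒^ [ fx≡y ] = 0 , fx≡y
  ⁺⇒^ {x} (fx≡z ∷ z⁺y) =
    let n , fⁿ⁺¹z≡y = ⁺⇒^ z⁺y
    in  suc n , trans (sym (^-comm (suc n) 1 x)) (trans (cong (f ^ suc n) fx≡z) fⁿ⁺¹z≡y)

  ^⇒⁺ : ∀ n x → TransClosure (λ u v → f u ≡ v) x ((f ^ suc n) x)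
  ^⇒⁺ zero    x = [ refl ]
  ^⇒⁺ (suc n) x = ^⇒⁺ n x ∷ʳ refl

Aperiodic : {A : Set} → (A → A) → ℕ → Set
Aperiodic f K = ∀ x {c e} → c ≤ K → e ≤ K → (f ^ c) x ≡ (f ^ e) x → c ≡ e

Aperiodic-mono : {A : Set} {f : A → A} {K K′ : ℕ} → K′ ≤ K → Aperiodic f K → Aperiodic f K′
Aperiodic-mono K′≤K ap x c≤K′ e≤K′ = ap x (≤-trans c≤K′ K′≤K) (≤-trans e≤K′ K′≤K)

module _ {A B : Set} (f : A → A) (g : B → B) where

  map-^₁ : ∀ n x → (Sum.map f g ^ n) (inj₁ x) ≡ inj₁ ((f ^ n) x)
  map-^₁ zero    x = refl
  map-^₁ (suc n) x = cong (Sum.map f g) (map-^₁ n x)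

  map-^₂ : ∀ n y → (Sum.map f g ^ n) (inj₂ y) ≡ inj₂ ((g ^ n) y)
  map-^₂ zero    y = refl
  map-^₂ (suc n) y = cong (Sum.map f g) (map-^₂ n y)

  map-injective : Injective _≡_ _≡_ f → Injective _≡_ _≡_ g → Injective _≡_ _≡_ (Sum.map f g)
  map-injective f-inj g-inj {inj₁ x} {inj₁ x′} eq = cong inj₁ (f-inj (Sum.inj₁-injective eq))
  map-injective f-inj g-inj {inj₂ y} {inj₂ y′} eq = cong inj₂ (g-inj (Sum.inj₂-injective eq))

  map-strictlySurjective : StrictlySurjective _≡_ f → StrictlySurjective _≡_ g →
                           StrictlySurjective _≡_ (Sum.map f g)
  map-strictlySurjective f-surj g-surj (inj₁ x) = let w , fw≡x = f-surj x in inj₁ w , cong inj₁ fw≡x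
  map-strictlySurjective f-surj g-surj (inj₂ y) = let w , gw≡y = g-surj y in inj₂ w , cong inj₂ gw≡y

  map-aperiodic : ∀ {K} → Aperiodic f K → Aperiodic g K → Aperiodic (Sum.map f g) K
  map-aperiodic f-ap g-ap (inj₁ x) {c} {e} c≤K e≤K eq =
    f-ap x c≤K e≤K (Sum.inj₁-injective (trans (sym (map-^₁ c x)) (trans eq (map-^₁ e x))))
  map-aperiodic f-ap g-ap (inj₂ y) {c} {e} c≤K e≤K eq =
    g-ap y c≤K e≤K (Sum.inj₂-injective (trans (sym (map-^₂ c y)) (trans eq (map-^₂ e y))))

-- The labels are constant along orbits and take every value, so finitely many
-- points never exhaust the orbits.
record SuccessorSystem : Set₁ where
  field
    Point           : Set
    _≟_             : DecidableEquality Point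
    next            : Point → Point
    next-injective  : Injective _≡_ _≡_ next
    next-surjective : StrictlySurjective _≡_ next
    label           : Point → ℕ
    label-next      : ∀ x → label (next x) ≡ label x
    withLabel       : ℕ → Point
    label-withLabel : ∀ n → label (withLabel n) ≡ n

toARS : SuccessorSystem → ARS
toARS S = record { Carrier = Point ; _⟶_ = λ x y → next x ≡ y ; inhabitant = withLabel 0 }
  where open SuccessorSystem S

module Orbits (S : SuccessorSystem) where
  open SuccessorSystem S public

  outsideOrbits : ∀ {n} (σ : Fin n → Point) → ∃ λ y → ∀ j c e → (next ^ c) y ≢ (next ^ e) (σ j)
  outsideOrbits σ = withLabel (suc M) , apart
    where
      M : ℕ
      M = maximum (label ∘ σ)
      label-^ : ∀ n x → label ((next ^ n) x) ≡ label x
      label-^ = ^-preserves next label label-next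
      apart : ∀ j c e → (next ^ c) (withLabel (suc M)) ≢ (next ^ e) (σ j)
      apart j c e eq = 1+n≰n (begin
        suc M                                 ≡⟨ label-withLabel (suc M) ⟨
        label (withLabel (suc M))             ≡⟨ label-^ c _ ⟨
        label ((next ^ c) (withLabel (suc M))) ≡⟨ cong label eq ⟩
        label ((next ^ e) (σ j))              ≡⟨ label-^ e (σ j) ⟩
        label (σ j)                           ≤⟨ ≤-maximum (label ∘ σ) j ⟩
        M                                     ∎)
        where open ≤-Reasoning

  Near : ℕ → ∀ {n} → (Fin n → Point) → Point → Set
  Near K ρ x = ∃ λ i → ∃ λ a → a < suc K × ∃ λ b → b < suc K × (next ^ a) (ρ i) ≡ (next ^ b) x

  near? : ∀ K {n} (ρ : Fin n → Point) x → Dec (Near K ρ x)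
  near? K ρ x = Fin.any? λ i → anyUpTo? (λ a → anyUpTo? (λ b → (next ^ a) (ρ i) ≟ (next ^ b) x) (suc K)) (suc K)

module _ (S : SuccessorSystem) where
  open SuccessorSystem S

  aperiodic⇒acyclic : (∀ K → Aperiodic next K) → Acyclic (toARS S)
  aperiodic⇒acyclic ap x⁺y refl = let n , eq = ⁺⇒^ next x⁺y in 1+n≢0 (ap (suc n) _ ≤-refl z≤n eq)

  cycle⇒notAcyclic : ∀ n x → (next ^ suc n) x ≡ x → NotAC (toARS S)
  cycle⇒notAcyclic n x cycle acyclic = acyclic (^⇒⁺ next n x) (sym cycle)

module _ (S T : SuccessorSystem) where
  private
    module S = SuccessorSystem S
    module T = SuccessorSystem T

  Similar : ℕ → ∀ {n} → (Fin n → S.Point) → (Fin n → T.Point) → Set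
  Similar K ρ σ = ∀ i j {a b} → a ≤ K → b ≤ K →
    ((S.next ^ a) (ρ i) ≡ (S.next ^ b) (ρ j)) ⇔ ((T.next ^ a) (σ i) ≡ (T.next ^ b) (σ j))

module _ (S T : SuccessorSystem) where
  private
    module S = Orbits S
    module T = Orbits T

  Similar-sym : ∀ {K n} {ρ : Fin n → S.Point} {σ : Fin n → T.Point} →
                Similar S T K ρ σ → Similar T S K σ ρ
  Similar-sym sim i j a≤K b≤K = ⇔.sym (sim i j a≤K b≤K)

  Similar-mono : ∀ {K K′ n} {ρ : Fin n → S.Point} {σ : Fin n → T.Point} →
                 K′ ≤ K → Similar S T K ρ σ → Similar S T K′ ρ σ
  Similar-mono K′≤K sim i j a≤K′ b≤K′ = sim i j (≤-trans a≤K′ K′≤K) (≤-trans b≤K′ K′≤K)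

  Similar-extend : ∀ {K n} {ρ : Fin n → S.Point} {σ : Fin n → T.Point} {x y} →
    Similar S T K ρ σ →
    (∀ j {c e} → c ≤ K → e ≤ K →
      ((S.next ^ c) x ≡ (S.next ^ e) (ρ j)) ⇔ ((T.next ^ c) y ≡ (T.next ^ e) (σ j))) →
    (∀ {c e} → c ≤ K → e ≤ K → ((S.next ^ c) x ≡ (S.next ^ e) x) ⇔ ((T.next ^ c) y ≡ (T.next ^ e) y)) →
    Similar S T K (extend x ρ) (extend y σ)
  Similar-extend sim new self zero    zero    c≤K e≤K = self c≤K e≤K
  Similar-extend sim new self zero    (suc j) c≤K e≤K = new j c≤K e≤K
  Similar-extend sim new self (suc i) zero    c≤K e≤K = ⇔.trans (mk⇔ sym sym) (⇔.trans (new i e≤K c≤K) (mk⇔ sym sym))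
  Similar-extend sim new self (suc i) (suc j)         = sim i j

  near-extension : ∀ {K n} {ρ : Fin n → S.Point} {σ : Fin n → T.Point} {x} →
    Similar S T (K + K) ρ σ → S.Near K ρ x → ∃ λ y → Similar S T K (extend x ρ) (extend y σ)
  near-extension {K} {ρ = ρ} {σ} {x} sim (i , a , a<1+K , b , b<1+K , aρᵢ≡bx) =
    y , Similar-extend (Similar-mono (m≤m+n K K) sim) new self
    where
      a≤K : a ≤ K
      a≤K = s≤s⁻¹ a<1+K
      b≤K : b ≤ K
      b≤K = s≤s⁻¹ b<1+K
      preimage : ∃ λ w → (T.next ^ b) w ≡ σ i
      preimage = ^-strictlySurjective T.next T.next-surjective b (σ i)
      y : T.Point
      y = (T.next ^ a) (proj₁ preimage)
      aσᵢ≡by : (T.next ^ a) (σ i) ≡ (T.next ^ b) y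
      aσᵢ≡by = trans (cong (T.next ^ a) (sym (proj₂ preimage))) (^-comm T.next a b (proj₁ preimage))
      new : ∀ j {c e} → c ≤ K → e ≤ K →
            ((S.next ^ c) x ≡ (S.next ^ e) (ρ j)) ⇔ ((T.next ^ c) y ≡ (T.next ^ e) (σ j))
      new j {c} {e} c≤K e≤K =
        ⇔.trans (^-shift-⇔ S.next S.next-injective aρᵢ≡bx c e (ρ j))
          (⇔.trans (sim i j (+-mono-≤ c≤K a≤K) (+-mono-≤ e≤K b≤K))
            (⇔.sym (^-shift-⇔ T.next T.next-injective aσᵢ≡by c e (σ j))))
      self : ∀ {c e} → c ≤ K → e ≤ K → ((S.next ^ c) x ≡ (S.next ^ e) x) ⇔ ((T.next ^ c) y ≡ (T.next ^ e) y)
      self {c} {e} c≤K e≤K =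
        ⇔.trans (^-shift-self-⇔ S.next S.next-injective {b = b} aρᵢ≡bx c e)
          (⇔.trans (sim i i (+-mono-≤ c≤K a≤K) (+-mono-≤ e≤K a≤K))
            (⇔.sym (^-shift-self-⇔ T.next T.next-injective {b = b} aσᵢ≡by c e)))

  far-extension : ∀ {K n} {ρ : Fin n → S.Point} {σ : Fin n → T.Point} {x} →
    Aperiodic S.next K → Aperiodic T.next K →
    Similar S T K ρ σ → ¬ S.Near K ρ x → ∃ λ y → Similar S T K (extend x ρ) (extend y σ)
  far-extension {K} {ρ = ρ} {σ} {x} S-ap T-ap sim far = y , Similar-extend sim new self
    where
      y : T.Point
      y = proj₁ (T.outsideOrbits σ)
      new : ∀ j {c e} → c ≤ K → e ≤ K →
            ((S.next ^ c) x ≡ (S.next ^ e) (ρ j)) ⇔ ((T.next ^ c) y ≡ (T.next ^ e) (σ j))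
      new j {c} {e} c≤K e≤K = mk⇔
        (λ eq → ⊥-elim (far (j , e , s≤s e≤K , c , s≤s c≤K , sym eq)))
        (λ eq → ⊥-elim (proj₂ (T.outsideOrbits σ) j c e eq))
      self : ∀ {c e} → c ≤ K → e ≤ K → ((S.next ^ c) x ≡ (S.next ^ e) x) ⇔ ((T.next ^ c) y ≡ (T.next ^ e) y)
      self c≤K e≤K = mk⇔
        (λ eq → cong (λ k → (T.next ^ k) y) (S-ap x c≤K e≤K eq))
        (λ eq → cong (λ k → (S.next ^ k) x) (T-ap y c≤K e≤K eq))

  forth : ∀ {K n} {ρ : Fin n → S.Point} {σ : Fin n → T.Point} →
    Aperiodic S.next K → Aperiodic T.next K →
    Similar S T (K + K) ρ σ → ∀ x → ∃ λ y → Similar S T K (extend x ρ) (extend y σ)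
  forth {K} {ρ = ρ} S-ap T-ap sim x with S.near? K ρ x
  ... | yes near = near-extension sim near
  ... | no  far  = far-extension S-ap T-ap (Similar-mono (m≤m+n K K) sim) far

depth : ∀ {n} → Fm n → ℕ
depth (i ≐ j)  = 0
depth (i ⇀ j)  = 0
depth falsum   = 0
depth (φ ∧′ ψ) = depth φ ⊔ depth ψ
depth (φ ∨′ ψ) = depth φ ⊔ depth ψ
depth (φ ⇒′ ψ) = depth φ ⊔ depth ψ
depth (∀′ φ)   = suc (depth φ)
depth (∃′ φ)   = suc (depth φ)

radius : ℕ → ℕ
radius zero    = 1
radius (suc d) = radius d + radius d

1≤radius : ∀ d → 1 ≤ radius d
1≤radius zero    = ≤-refl
1≤radius (suc d) = ≤-trans (1≤radius d) (m≤m+n (radius d) (radius d))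

module _ (S T : SuccessorSystem) {N : ℕ}
         (S-ap : Aperiodic (SuccessorSystem.next S) N) (T-ap : Aperiodic (SuccessorSystem.next T) N) where
  private
    module S = SuccessorSystem S
    module T = SuccessorSystem T

    back : ∀ {K n} {ρ : Fin n → S.Point} {σ : Fin n → T.Point} → K ≤ N →
           Similar S T (K + K) ρ σ → ∀ y → ∃ λ x → Similar S T K (extend x ρ) (extend y σ)
    back K≤N sim y =
      let x , sim′ = forth T S (Aperiodic-mono K≤N T-ap) (Aperiodic-mono K≤N S-ap) (Similar-sym S T sim) y
      in  x , Similar-sym T S sim′

  Sat-⇔ : ∀ {n} (φ : Fm n) d → depth φ ≤ d → radius d ≤ N →
          {ρ : Fin n → S.Point} {σ : Fin n → T.Point} →
          Similar S T (radius d) ρ σ → Sat (toARS S) φ ρ ⇔ Sat (toARS T) φ σ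
  Sat-⇔ (i ≐ j)  d _ _ sim = sim i j z≤n z≤n
  Sat-⇔ (i ⇀ j)  d _ _ sim = sim i j (1≤radius d) z≤n
  Sat-⇔ falsum   d _ _ _   = ⇔.refl
  Sat-⇔ (φ ∧′ ψ) d φψ≤d r≤N sim =
    Sat-⇔ φ d (m⊔n≤o⇒m≤o _ _ φψ≤d) r≤N sim ×-⇔ Sat-⇔ ψ d (m⊔n≤o⇒n≤o _ _ φψ≤d) r≤N sim
  Sat-⇔ (φ ∨′ ψ) d φψ≤d r≤N sim =
    Sat-⇔ φ d (m⊔n≤o⇒m≤o _ _ φψ≤d) r≤N sim ⊎-⇔ Sat-⇔ ψ d (m⊔n≤o⇒n≤o _ _ φψ≤d) r≤N sim
  Sat-⇔ (φ ⇒′ ψ) d φψ≤d r≤N sim =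
    →-cong-⇔ (Sat-⇔ φ d (m⊔n≤o⇒m≤o _ _ φψ≤d) r≤N sim) (Sat-⇔ ψ d (m⊔n≤o⇒n≤o _ _ φψ≤d) r≤N sim)
  Sat-⇔ (∀′ φ) (suc d) (s≤s φ≤d) r≤N {ρ} {σ} sim =
    Π-cong-⇔ (λ x y → Similar S T (radius d) (extend x ρ) (extend y σ))
      (forth S T (Aperiodic-mono K≤N S-ap) (Aperiodic-mono K≤N T-ap) sim) (back K≤N sim)
      (Sat-⇔ φ d φ≤d K≤N)
    where
      K≤N : radius d ≤ N
      K≤N = ≤-trans (m≤m+n (radius d) (radius d)) r≤N
  Sat-⇔ (∃′ φ) (suc d) (s≤s φ≤d) r≤N {ρ} {σ} sim =
    Σ-cong-⇔ (λ x y → Similar S T (radius d) (extend x ρ) (extend y σ))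
      (forth S T (Aperiodic-mono K≤N S-ap) (Aperiodic-mono K≤N T-ap) sim) (back K≤N sim)
      (Sat-⇔ φ d φ≤d K≤N)
    where
      K≤N : radius d ≤ N
      K≤N = ≤-trans (m≤m+n (radius d) (radius d)) r≤N

aperiodic⇒⊨-⇔ : ∀ S T (φ : Sentence) →
  Aperiodic (SuccessorSystem.next S) (radius (depth φ)) → Aperiodic (SuccessorSystem.next T) (radius (depth φ)) →
  toARS S ⊨ φ ⇔ toARS T ⊨ φ
aperiodic⇒⊨-⇔ S T φ S-ap T-ap = Sat-⇔ S T S-ap T-ap φ (depth φ) ≤-refl ≤-refl (λ ())

module ℤ-Group = AbelianGroupProperties ℤ.+-0-abelianGroup

chain-next : ℤ × ℕ → ℤ × ℕ
chain-next = map₁ ℤ.suc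

chain-next^ : ∀ c z k → (chain-next ^ c) (z , k) ≡ (+ c ℤ.+ z , k)
chain-next^ zero    z k = cong (_, k) (sym (ℤ.+-identityˡ z))
chain-next^ (suc c) z k = trans (cong chain-next (chain-next^ c z k)) (cong (_, k) (sym (ℤ.suc-+ c z)))

chain-next-injective : Injective _≡_ _≡_ chain-next
chain-next-injective eq =
  cong₂ _,_ (ℤ-Group.∙-cancelˡ (+ 1) _ _ (Product.,-injectiveˡ eq)) (Product.,-injectiveʳ eq)

chain-next-surjective : StrictlySurjective _≡_ chain-next
chain-next-surjective (z , k) = (ℤ.pred z , k) , cong (_, k) (ℤ.suc-pred z)

chain-next-aperiodic : ∀ K → Aperiodic chain-next K
chain-next-aperiodic K (z , k) {c} {e} _ _ eq = ℤ.+-injective (ℤ-Group.∙-cancelʳ z (+ c) (+ e)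
  (Product.,-injectiveˡ (trans (sym (chain-next^ c z k)) (trans eq (chain-next^ e z k)))))

Chains : SuccessorSystem
Chains = record
  { Point           = ℤ × ℕ
  ; _≟_             = Product.≡-dec ℤ._≟_ ℕ._≟_
  ; next            = chain-next
  ; next-injective  = chain-next-injective
  ; next-surjective = chain-next-surjective
  ; label           = proj₂
  ; label-next      = λ _ → refl
  ; withLabel       = λ k → (+ 0 , k)
  ; label-withLabel = λ _ → refl
  }

chains-acyclic : Acyclic (toARS Chains)
chains-acyclic = aperiodic⇒acyclic Chains chain-next-aperiodic

module _ (m : ℕ) where

  rotate : Fin (suc m) → Fin (suc m)
  rotate i = fromℕ< (m%n<n (suc (toℕ i)) (suc m))

  toℕ-rotate^-zero : ∀ {c} → c ≤ m → toℕ ((rotate ^ c) zero) ≡ c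
  toℕ-rotate^-zero {zero}  _     = refl
  toℕ-rotate^-zero {suc c} 1+c≤m = begin
    toℕ (rotate ((rotate ^ c) zero))       ≡⟨ Fin.toℕ-fromℕ< _ ⟩
    suc (toℕ ((rotate ^ c) zero)) % suc m  ≡⟨ cong (λ k → suc k % suc m) (toℕ-rotate^-zero (<⇒≤ 1+c≤m)) ⟩
    suc c % suc m                          ≡⟨ m≤n⇒m%n≡m 1+c≤m ⟩
    suc c                                  ∎
    where open ≡-Reasoning

  rotate^toℕ : ∀ i → (rotate ^ toℕ i) zero ≡ i
  rotate^toℕ i = Fin.toℕ-injective (toℕ-rotate^-zero (Fin.toℕ≤pred[n] i))

  rotate^-via-zero : ∀ c i → (rotate ^ c) i ≡ (rotate ^ toℕ i) ((rotate ^ c) zero)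
  rotate^-via-zero c i = trans (cong (rotate ^ c) (sym (rotate^toℕ i))) (^-comm rotate c (toℕ i) zero)

  rotate-period : ∀ i → (rotate ^ suc m) i ≡ i
  rotate-period i = begin
    (rotate ^ suc m) i                        ≡⟨ rotate^-via-zero (suc m) i ⟩
    (rotate ^ toℕ i) ((rotate ^ suc m) zero)  ≡⟨ cong (rotate ^ toℕ i) wrap ⟩
    (rotate ^ toℕ i) zero                     ≡⟨ rotate^toℕ i ⟩
    i                                         ∎
    where
      open ≡-Reasoning
      wrap : (rotate ^ suc m) zero ≡ zero
      wrap = Fin.toℕ-injective (begin
        toℕ ((rotate ^ suc m) zero)            ≡⟨ Fin.toℕ-fromℕ< _ ⟩
        suc (toℕ ((rotate ^ m) zero)) % suc m  ≡⟨ cong (λ k → suc k % suc m) (toℕ-rotate^-zero ≤-refl) ⟩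
        suc m % suc m                          ≡⟨ n%n≡0 (suc m) ⟩
        0                                      ∎)

  rotate-injective : Injective _≡_ _≡_ rotate
  rotate-injective = periodic⇒injective rotate {m} rotate-period

  rotate-aperiodic : Aperiodic rotate m
  rotate-aperiodic i {c} {e} c≤m e≤m eq = begin
    c                        ≡⟨ toℕ-rotate^-zero c≤m ⟨
    toℕ ((rotate ^ c) zero)  ≡⟨ cong toℕ (^-injective rotate rotate-injective (toℕ i) shifted) ⟩
    toℕ ((rotate ^ e) zero)  ≡⟨ toℕ-rotate^-zero e≤m ⟩
    e                        ∎
    where
      open ≡-Reasoning
      shifted : (rotate ^ toℕ i) ((rotate ^ c) zero) ≡ (rotate ^ toℕ i) ((rotate ^ e) zero)
      shifted = trans (sym (rotate^-via-zero c i)) (trans eq (rotate^-via-zero e i))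

  CycleAndChains : SuccessorSystem
  CycleAndChains = record
    { Point           = Fin (suc m) ⊎ ℤ × ℕ
    ; _≟_             = Sum.≡-dec Fin._≟_ (SuccessorSystem._≟_ Chains)
    ; next            = Sum.map rotate chain-next
    ; next-injective  = map-injective rotate chain-next rotate-injective chain-next-injective
    ; next-surjective = map-strictlySurjective rotate chain-next
                          (periodic⇒strictlySurjective rotate {m} rotate-period) chain-next-surjective
    ; label           = Sum.[ const 0 , proj₂ ]
    ; label-next      = λ { (inj₁ _) → refl ; (inj₂ _) → refl }
    ; withLabel       = λ k → inj₂ (+ 0 , k)
    ; label-withLabel = λ _ → refl
    }

  cycleAndChains-notAC : NotAC (toARS CycleAndChains)
  cycleAndChains-notAC =
    cycle⇒notAcyclic CycleAndChains m (inj₁ zero) (trans (map-^₁ rotate chain-next (suc m) zero) (cong inj₁ (rotate-period zero)))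

  cycleAndChains-aperiodic : Aperiodic (Sum.map rotate chain-next) m
  cycleAndChains-aperiodic = map-aperiodic rotate chain-next rotate-aperiodic (chain-next-aperiodic m)

theorem3p10 : ¬ GeneralisedFO NotAC
theorem3p10 (Φ , notAC⇔⊨Φ) = Equivalence.from (notAC⇔⊨Φ (toARS Chains)) chains⊨Φ chains-acyclic
  where
    chains⊨Φ : toARS Chains ⊨ₛ Φ
    chains⊨Φ φ φ∈Φ =
      let r = radius (depth φ)
          cycleAndChains⊨Φ = Equivalence.to (notAC⇔⊨Φ (toARS (CycleAndChains r))) (cycleAndChains-notAC r)
      in  Equivalence.to (aperiodic⇒⊨-⇔ (CycleAndChains r) Chains φ (cycleAndChains-aperiodic r) (chain-next-aperiodic r))
                         (cycleAndChains⊨Φ φ φ∈Φ)
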